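{- Let $G$ be a finite simple connected graph and let $S\subseteq V(G)$ be a minimal clique cut-set of $G$ with $|S|=2$. Let $G_1,\dots,G_\ell$, $\ell\ge 2$, be the connected components of $G-S$, and let $\widehat{G_i}=G[V(G_i)\cup S]$ for $i\in[\ell]$. Then: (i) $\max\{\mathrm{f}\mu^{1}(\widehat{G_i}): i\in[\ell]\}\le \mathrm{f}\mu^{1}(G)\le \sum_{i=1}^{\ell}\mathrm{f}\mu^{1}(\widehat{G_i})$, and both bounds are sharp (i.e., each of the two inequalities holds with equality for some connected graph $G$ with such a minimal clique cut-set $S$ of size two); (ii) if $k\ge 2$, then $\mathrm{f}\mu^{k}(G)=\max\{\mathrm{f}\mu^{k}(\widehat{G_i}): i\in[\ell]\}$.
   Context: For an integer $k\ge 0$ and a connected graph $G$, a set $X\subseteq V(G)$ is a $k$-fault-tolerant mutual-visibility set ($k$-ftmv set) if for any two non-adjacent vertices $u,v\in X$ there exist $k+1$ internally vertex-disjoint shortest $u,v$-paths $Q_1,\dots,Q_{k+1}$ in $G$ such that $V(Q_i)\cap X=\{u,v\}$ for every $i$. $\mathrm{f}\mu^{k}(G)$ denotes the maximum cardinality of a $k$-ftmv set of $G$. A set $S\subseteq V(G)$ is a clique cut-set if $G[S]$ is a clique and $G-S$ is disconnected; it is minimal if it contains no proper subset that is a clique cut-set. $G[Y]$ denotes the subgraph induced by $Y$. -}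

module Defs where

open import Data.Bool using (Bool; true; false; T)
open import Data.Nat using (ℕ; zero; suc; _+_; _≤_; _⊔_)
open import Data.Fin using (Fin; zero; suc)
open import Data.Fin.Subset using (Subset; _∈_; _∉_; _⊆_; ∁; _∪_; ∣_∣; ⊤)
open import Data.List using (List; []; _∷_; length)
open import Data.List.Relation.Unary.Unique.Propositional using (Unique)
import Data.List.Membership.Propositional as LM
open import Data.Product using (Σ; ∃; _×_; _,_)
open import Data.Sum using (_⊎_)
open import Relation.Binary.PropositionalEquality using (_≡_; _≢_)
open import Relation.Nullary using (¬_)

record Graph (n : ℕ) : Set where
  field
    adj    : Fin n → Fin n → Bool
    sym    : ∀ u v → adj u v ≡ adj v u
    irrefl : ∀ u → adj u u ≡ false

open Graph public

Adj : ∀ {n} → Graph n → Fin n → Fin n → Set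
Adj G u v = T (adj G u v)

data WalkIn {n} (G : Graph n) (Y : Subset n) : Fin n → Fin n → List (Fin n) → Set where
  single : ∀ {u} → u ∈ Y → WalkIn G Y u u (u ∷ [])
  step   : ∀ {u w v p} → u ∈ Y → Adj G u w → WalkIn G Y w v p → WalkIn G Y u v (u ∷ p)

PathIn : ∀ {n} → Graph n → Subset n → Fin n → Fin n → List (Fin n) → Set
PathIn G Y u v p = WalkIn G Y u v p × Unique p

-- Shortest u,v-paths in G[Y]  (length of a path = number of vertices - 1,
-- so comparing numbers of vertices is the same as comparing lengths).
ShortestPathIn : ∀ {n} → Graph n → Subset n → Fin n → Fin n → List (Fin n) → Set
ShortestPathIn G Y u v p =
  PathIn G Y u v p × (∀ q → PathIn G Y u v q → length p ≤ length q)

ConnectedIn : ∀ {n} → Graph n → Subset n → Set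
ConnectedIn G Y = ∀ u v → u ∈ Y → v ∈ Y → ∃ λ p → WalkIn G Y u v p

DisconnectedIn : ∀ {n} → Graph n → Subset n → Set
DisconnectedIn G Y = Σ _ λ u → Σ _ λ v → u ∈ Y × v ∈ Y × ¬ (∃ λ p → WalkIn G Y u v p)

Clique : ∀ {n} → Graph n → Subset n → Set
Clique G S = ∀ u v → u ∈ S → v ∈ S → u ≢ v → Adj G u v

CliqueCutSet : ∀ {n} → Graph n → Subset n → Set
CliqueCutSet G S = Clique G S × DisconnectedIn G (∁ S)

MinimalCliqueCutSet : ∀ {n} → Graph n → Subset n → Set
MinimalCliqueCutSet G S =
  CliqueCutSet G S × (∀ T → T ⊆ S → T ≢ S → ¬ CliqueCutSet G T)

record IsComponentsOf {n} (G : Graph n) (S : Subset n) (ℓ : ℕ) (C : Fin ℓ → Subset n) : Set where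
  field
    inside    : ∀ i → C i ⊆ ∁ S
    nonempty  : ∀ i → ∃ λ v → v ∈ C i
    cover     : ∀ v → v ∉ S → ∃ λ i → v ∈ C i
    disjoint  : ∀ i j v → v ∈ C i → v ∈ C j → i ≡ j
    connected : ∀ i u v → u ∈ C i → v ∈ C i → ∃ λ p → WalkIn G (∁ S) u v p
    separated : ∀ i j u v → u ∈ C i → v ∈ C j → (∃ λ p → WalkIn G (∁ S) u v p) → i ≡ j

IsFTMV : ∀ {n} → ℕ → Graph n → Subset n → Subset n → Set
IsFTMV {n} k G Y X =
  X ⊆ Y ×
  (∀ u v → u ∈ X → v ∈ X → u ≢ v → ¬ Adj G u v →
    Σ (Fin (suc k) → List (Fin n)) λ Q →
      (∀ i → ShortestPathIn G Y u v (Q i)) ×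
      (∀ i w → w LM.∈ Q i → w ∈ X → w ≡ u ⊎ w ≡ v) ×
      (∀ i j → i ≢ j → ∀ w → w LM.∈ Q i → w LM.∈ Q j → w ≡ u ⊎ w ≡ v))

IsFMu : ∀ {n} → ℕ → Graph n → Subset n → ℕ → Set
IsFMu k G Y m =
  (∃ λ X → IsFTMV k G Y X × ∣ X ∣ ≡ m) × (∀ X → IsFTMV k G Y X → ∣ X ∣ ≤ m)

maxF : ∀ {ℓ} → (Fin ℓ → ℕ) → ℕ
maxF {zero}  f = 0
maxF {suc ℓ} f = f zero ⊔ maxF (λ i → f (suc i))

sumF : ∀ {ℓ} → (Fin ℓ → ℕ) → ℕ
sumF {zero}  f = 0
sumF {suc ℓ} f = f zero + sumF (λ i → f (suc i))

record Setting (n : ℕ) : Set where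
  field
    graph     : Graph n
    conn      : ConnectedIn graph ⊤
    S         : Subset n
    minCCS    : MinimalCliqueCutSet graph S
    size2     : ∣ S ∣ ≡ 2
    ℓ         : ℕ
    comps     : Fin ℓ → Subset n
    isComps   : IsComponentsOf graph S ℓ comps
    two≤ℓ     : 2 ≤ ℓ

open Setting public

hat : ∀ {n} (σ : Setting n) → Fin (ℓ σ) → Subset n
hat σ i = comps σ i ∪ S σ

Fin' : ∀ {n} → Setting n → Set
Fin' σ = Fin (ℓ σ)

{-# OPTIONS --safe #-}
module Submission where

-- Every edge leaving Ĝᵢ = G[V(Gᵢ) ∪ S] ends inside the clique S, so a path that
-- leaves Ĝᵢ can be shortcut by an edge of S: Ĝᵢ is convex in G.  Hence k-ftmv sets
-- of Ĝᵢ are k-ftmv sets of G, and a k-ftmv set X of G splits into the k-ftmv sets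
-- X ∩ V(Ĝᵢ) of the Ĝᵢ, which cover X; these are the two bounds of (i).  For k ≥ 2
-- two vertices of X in different components would need k + 1 ≥ 3 internally
-- disjoint paths, each through the two-element set S; so X lies in a single Ĝᵢ,
-- which gives (ii).  The bounds of (i) are attained by the diamond K₄ − e and by two
-- stars K₁,₃ both joined to the edge st.  In these examples fμ¹ is bounded by a
-- finite search, using that two vertices of a 1-ftmv set at distance two force two
-- vertices outside the set: the middles of two disjoint shortest paths.

open import Defs hiding (sym)
open import Data.Bool using (Bool; T; true; false; _∧_; _∨_)
open import Data.Bool.ListAction using (any)
open import Data.Bool.Properties using (∨-comm) renaming (_≟_ to _≟ᵇ_)
open import Data.Nat using (ℕ; zero; suc; _+_; _≤_; _<_; z≤n; s≤s; _≡ᵇ_)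
open import Data.Nat.Properties
  using (≤-trans; ≤-refl; ≤-antisym; <⇒≤; <⇒≱; m<n⇒m<1+n; n≮n; +-suc; +-mono-≤;
         ⊔-lub; m≤m⊔n; m≤n⊔m; _≤?_; _<?_)
  renaming (_≟_ to _≟ℕ_)
open import Data.Fin using (Fin; zero; suc; toℕ; fromℕ<; #_)
open import Data.Fin.Properties using (_≟_; any?; all?; ¬Fin0)
open import Data.Fin.Subset
  using (Subset; _∈_; _∉_; _⊆_; ∁; _∪_; _∩_; _─_; ⁅_⁆; ∣_∣; ⊤; ⊥)
open import Data.Fin.Subset.Properties
  using (_∈?_; _⊆?_; anySubset?; ∈⊤; ⊆-antisym; p⊆p∪q; q⊆p∪q; x∈p∪q⁻; x∈p∩q⁺; x∈p∩q⁻;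
         p∩q⊆p; p∩q⊆q; x∈∁p⇒x∉p; x∉p⇒x∈∁p; x∈⁅x⁆; x∈⁅y⁆⇒x≡y; p⊆q⇒∣p∣≤∣q∣; ∣⊥∣≡0;
         x∈p⇒∣p-x∣<∣p∣; x∈p∧x≢y⇒x∈p-y; x∈p∧x∉q⇒x∈p─q)
open import Data.List using (List; []; _∷_; length; map; _++_)
open import Data.Vec using ([]; _∷_)
open import Data.List.Membership.Propositional using () renaming (_∈_ to _∈ₗ_)
open import Data.List.Relation.Binary.Subset.Propositional using () renaming (_⊆_ to _⊆ₗ_)
open import Data.List.Relation.Binary.Subset.Propositional.Properties using (∷⁺ʳ)
open import Data.List.Relation.Unary.Any using (here; there)
open import Data.List.Relation.Unary.All using ([]; _∷_; lookup)
open import Data.List.Relation.Unary.All.Properties using (anti-mono)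
open import Data.List.Relation.Unary.AllPairs using ([]; _∷_)
open import Data.Product using (Σ; ∃; ∃₂; _×_; _,_; proj₁; proj₂)
open import Data.Sum using (_⊎_; inj₁; inj₂; [_,_])
open import Data.Empty using (⊥-elim)
open import Function using (_∘_; id)
open import Relation.Binary.PropositionalEquality using (_≡_; _≢_; refl; sym; trans; subst)
open import Relation.Nullary using (¬_; Dec; yes; no)
open import Relation.Nullary.Decidable
  using (True; toWitness; from-yes; map′; decidable-stable; ¬?; _×-dec_; _⊎-dec_; _→-dec_; T?)
open import Relation.Unary using (Pred; Decidable)

module _ {n : ℕ} where

  Adj-sym : (G : Graph n) {u v : Fin n} → Adj G u v → Adj G v u
  Adj-sym G {u} {v} = subst T (Graph.sym G u v)

  Adj⇒≢ : (G : Graph n) {u v : Fin n} → Adj G u v → u ≢ v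
  Adj⇒≢ G {u} uu refl = subst T (irrefl G u) uu

  module _ {G : Graph n} where

    walk-mono : ∀ {Y Z u v p} → Y ⊆ Z → WalkIn G Y u v p → WalkIn G Z u v p
    walk-mono Y⊆Z (single u∈Y)       = single (Y⊆Z u∈Y)
    walk-mono Y⊆Z (step u∈Y uw walk) = step (Y⊆Z u∈Y) uw (walk-mono Y⊆Z walk)

    path-mono : ∀ {Y Z u v p} → Y ⊆ Z → PathIn G Y u v p → PathIn G Z u v p
    path-mono Y⊆Z (walk , unique) = walk-mono Y⊆Z walk , unique

    walk-source : ∀ {Y u v p} → WalkIn G Y u v p → u ∈ Y
    walk-source (single u∈Y)   = u∈Y
    walk-source (step u∈Y _ _) = u∈Y

    walk-target : ∀ {Y u v p} → WalkIn G Y u v p → v ∈ Y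
    walk-target (single v∈Y)    = v∈Y
    walk-target (step _ _ walk) = walk-target walk

    walk-head : ∀ {Y u v p} → WalkIn G Y u v p → u ∈ₗ p
    walk-head (single _)   = here refl
    walk-head (step _ _ _) = here refl

    universal⇒walk : ∀ {Y Z : Subset n} h → h ∈ Z → Y ⊆ Z →
                     (∀ x → x ∈ Y → x ≢ h → Adj G h x) →
                     ∀ u v → u ∈ Y → v ∈ Y → ∃ λ p → WalkIn G Z u v p
    universal⇒walk h h∈Z Y⊆Z h-adj u v u∈Y v∈Y with u ≟ h | v ≟ h
    ... | yes refl | yes refl = _ , single h∈Z
    ... | yes refl | no v≢h   = _ , step h∈Z (h-adj v v∈Y v≢h) (single (Y⊆Z v∈Y))
    ... | no u≢h   | yes refl = _ , step (Y⊆Z u∈Y) (Adj-sym G (h-adj u u∈Y u≢h)) (single h∈Z)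
    ... | no u≢h   | no v≢h   =
      _ , step (Y⊆Z u∈Y) (Adj-sym G (h-adj u u∈Y u≢h))
               (step h∈Z (h-adj v v∈Y v≢h) (single (Y⊆Z v∈Y)))

    walk-stays-in : ∀ {Z C : Subset n} → (∀ {x y} → x ∈ C → y ∈ Z → Adj G x y → y ∈ C) →
                    ∀ {u v p} → WalkIn G Z u v p → u ∈ C → v ∈ C
    walk-stays-in closed (single _)       u∈C = u∈C
    walk-stays-in closed (step _ uw walk) u∈C =
      walk-stays-in closed walk (closed u∈C (walk-source walk) uw)

    walk-meets-or-avoids : ∀ (S : Subset n) {u v p} → WalkIn G ⊤ u v p →
                           (∃ λ w → w ∈ₗ p × w ∈ S) ⊎ WalkIn G (∁ S) u v p
    walk-meets-or-avoids S {u} walk with u ∈? S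
    ... | yes u∈S = inj₁ (u , walk-head walk , u∈S)
    walk-meets-or-avoids S (single _)       | no u∉S = inj₂ (single (x∉p⇒x∈∁p u∉S))
    walk-meets-or-avoids S (step _ uw walk) | no u∉S with walk-meets-or-avoids S walk
    ... | inj₁ (w , w∈p , w∈S) = inj₁ (w , there w∈p , w∈S)
    ... | inj₂ avoiding        = inj₂ (step (x∉p⇒x∈∁p u∉S) uw avoiding)

module _ {n : ℕ} where

  x∈p⇒1≤∣p∣ : ∀ {p : Subset n} {x} → x ∈ p → 1 ≤ ∣ p ∣
  x∈p⇒1≤∣p∣ x∈p = ≤-trans (s≤s z≤n) (x∈p⇒∣p-x∣<∣p∣ x∈p)

  distinct₂⇒2≤∣p∣ : ∀ {p : Subset n} {x y} → x ∈ p → y ∈ p → x ≢ y → 2 ≤ ∣ p ∣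
  distinct₂⇒2≤∣p∣ x∈p y∈p x≢y =
    ≤-trans (s≤s (x∈p⇒1≤∣p∣ (x∈p∧x≢y⇒x∈p-y y∈p (x≢y ∘ sym)))) (x∈p⇒∣p-x∣<∣p∣ x∈p)

  distinct₃⇒3≤∣p∣ : ∀ {p : Subset n} {x y z} → x ∈ p → y ∈ p → z ∈ p →
                    x ≢ y → x ≢ z → y ≢ z → 3 ≤ ∣ p ∣
  distinct₃⇒3≤∣p∣ x∈p y∈p z∈p x≢y x≢z y≢z =
    ≤-trans (s≤s (distinct₂⇒2≤∣p∣ (x∈p∧x≢y⇒x∈p-y y∈p (x≢y ∘ sym))
                                  (x∈p∧x≢y⇒x∈p-y z∈p (x≢z ∘ sym)) y≢z))
            (x∈p⇒∣p-x∣<∣p∣ x∈p)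

∣p∣≤∣p∩q∣+∣p∩∁q∣ : ∀ {n} (p q : Subset n) → ∣ p ∣ ≤ ∣ p ∩ q ∣ + ∣ p ∩ ∁ q ∣
∣p∣≤∣p∩q∣+∣p∩∁q∣ []          []          = z≤n
∣p∣≤∣p∩q∣+∣p∩∁q∣ (true  ∷ p) (true  ∷ q) = s≤s (∣p∣≤∣p∩q∣+∣p∩∁q∣ p q)
∣p∣≤∣p∩q∣+∣p∩∁q∣ (true  ∷ p) (false ∷ q) =
  subst (suc ∣ p ∣ ≤_) (sym (+-suc ∣ p ∩ q ∣ ∣ p ∩ ∁ q ∣)) (s≤s (∣p∣≤∣p∩q∣+∣p∩∁q∣ p q))
∣p∣≤∣p∩q∣+∣p∩∁q∣ (false ∷ p) (true  ∷ q) = ∣p∣≤∣p∩q∣+∣p∩∁q∣ p q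
∣p∣≤∣p∩q∣+∣p∩∁q∣ (false ∷ p) (false ∷ q) = ∣p∣≤∣p∩q∣+∣p∩∁q∣ p q

sumF-mono : ∀ {ℓ} {f g : Fin ℓ → ℕ} → (∀ i → f i ≤ g i) → sumF f ≤ sumF g
sumF-mono {zero}  f≤g = z≤n
sumF-mono {suc ℓ} f≤g = +-mono-≤ (f≤g zero) (sumF-mono (f≤g ∘ suc))

maxF-lub : ∀ {ℓ} {f : Fin ℓ → ℕ} {m} → (∀ i → f i ≤ m) → maxF f ≤ m
maxF-lub {zero}  f≤m = z≤n
maxF-lub {suc ℓ} f≤m = ⊔-lub (f≤m zero) (maxF-lub (f≤m ∘ suc))

maxF-upper : ∀ {ℓ} (f : Fin ℓ → ℕ) i → f i ≤ maxF f
maxF-upper f zero    = m≤m⊔n (f zero) _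
maxF-upper f (suc i) = ≤-trans (maxF-upper (f ∘ suc) i) (m≤n⊔m (f zero) _)

∣p∣≤sumF∣p∩qᵢ∣ : ∀ {n ℓ} (p : Subset n) (q : Fin ℓ → Subset n) →
                 (∀ {x} → x ∈ p → ∃ λ i → x ∈ q i) → ∣ p ∣ ≤ sumF (λ i → ∣ p ∩ q i ∣)
∣p∣≤sumF∣p∩qᵢ∣ {n} {ℓ = zero} p q covered =
  subst (∣ p ∣ ≤_) (∣⊥∣≡0 n) (p⊆q⇒∣p∣≤∣q∣ {q = ⊥} (λ x∈p → ⊥-elim (¬Fin0 (proj₁ (covered x∈p)))))
∣p∣≤sumF∣p∩qᵢ∣ {ℓ = suc ℓ} p q covered =
  ≤-trans (∣p∣≤∣p∩q∣+∣p∩∁q∣ p (q zero))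
          (+-mono-≤ ≤-refl (≤-trans (∣p∣≤sumF∣p∩qᵢ∣ (p ∩ ∁ (q zero)) (q ∘ suc) covered-rest)
                                    (sumF-mono λ i → p⊆q⇒∣p∣≤∣q∣ (shrink i))))
  where
  covered-rest : ∀ {x} → x ∈ p ∩ ∁ (q zero) → ∃ λ i → x ∈ q (suc i)
  covered-rest x∈ with x∈p∩q⁻ p _ x∈
  ... | x∈p , x∉q₀ with covered x∈p
  ...   | zero  , x∈q₀ = ⊥-elim (x∈∁p⇒x∉p x∉q₀ x∈q₀)
  ...   | suc i , x∈qᵢ = i , x∈qᵢ
  shrink : ∀ i → (p ∩ ∁ (q zero)) ∩ q (suc i) ⊆ p ∩ q (suc i)
  shrink i x∈ with x∈p∩q⁻ _ _ x∈
  ... | x∈p∖q₀ , x∈qᵢ = x∈p∩q⁺ (p∩q⊆p _ _ x∈p∖q₀ , x∈qᵢ)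

<⊎≡⇒≤ : ∀ {A : Set} {q p : List A} → length q < length p ⊎ q ≡ p → length q ≤ length p
<⊎≡⇒≤ (inj₁ shorter) = <⇒≤ shorter
<⊎≡⇒≤ (inj₂ refl)    = ≤-refl

module CliqueBoundary {n} (G : Graph n) (H K : Subset n) (K-clique : Clique G K)
                      (boundary : ∀ {a b} → Adj G a b → a ∉ H → b ∈ H → b ∈ K) where

  SubPathIn : Fin n → Fin n → List (Fin n) → List (Fin n) → Set
  SubPathIn u v p q = PathIn G H u v q × q ⊆ₗ p

  shortcut : ∀ {u v p} → PathIn G ⊤ u v p → u ∈ H → v ∈ H →
             ∃ λ q → SubPathIn u v p q × (length q < length p ⊎ q ≡ p)
  reenter  : ∀ {w v p} → PathIn G ⊤ w v p → w ∉ H → v ∈ H →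
             ∃₂ λ x q → x ∈ K × SubPathIn x v p q × length q < length p

  shortcut (single _ , _) u∈H _ = _ , ((single u∈H , [] ∷ []) , id) , inj₂ refl
  shortcut {u} (step {w = w} _ uw walk , u∉p ∷ p-unique) u∈H v∈H with w ∈? H
  ... | yes w∈H with shortcut (walk , p-unique) w∈H v∈H
  ...   | q , ((q-walk , q-unique) , q⊆p) , q≤p =
    u ∷ q , ((step u∈H uw q-walk , anti-mono q⊆p u∉p ∷ q-unique) , ∷⁺ʳ u q⊆p) ,
    [ inj₁ ∘ s≤s , (λ { refl → inj₂ refl }) ] q≤p
  shortcut {u} (step {w = w} _ uw walk , u∉p ∷ p-unique) u∈H v∈H | no w∉H
    with reenter (walk , p-unique) w∉H v∈H
  ...   | x , q , x∈K , ((q-walk , q-unique) , q⊆p) , q<p =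
    u ∷ q , ((step u∈H ux q-walk , anti-mono q⊆p u∉p ∷ q-unique) , ∷⁺ʳ u q⊆p) , inj₁ (s≤s q<p)
    where
    ux : Adj G u x
    ux = K-clique u x (boundary (Adj-sym G uw) w∉H u∈H) x∈K (lookup u∉p (q⊆p (walk-head q-walk)))

  reenter (single _ , _) w∉H v∈H = ⊥-elim (w∉H v∈H)
  reenter (step {w = x} _ wx walk , _ ∷ p-unique) w∉H v∈H with x ∈? H
  ... | yes x∈H with shortcut (walk , p-unique) x∈H v∈H
  ...   | q , (q-path , q⊆p) , q≤p =
    x , q , boundary wx w∉H x∈H , (q-path , there ∘ q⊆p) , s≤s (<⊎≡⇒≤ q≤p)
  reenter (step _ _ walk , _ ∷ p-unique) w∉H v∈H | no x∉H with reenter (walk , p-unique) x∉H v∈H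
  ...   | y , q , y∈K , (q-path , q⊆p) , q<p =
    y , q , y∈K , (q-path , there ∘ q⊆p) , m<n⇒m<1+n q<p

  shortest-restrict : ∀ {u v p} → ShortestPathIn G ⊤ u v p → u ∈ H → v ∈ H →
                      ShortestPathIn G H u v p
  shortest-restrict (p-path , p-min) u∈H v∈H with shortcut p-path u∈H v∈H
  ... | q , (q-path , _) , inj₁ q<p = ⊥-elim (<⇒≱ q<p (p-min q (path-mono (λ _ → ∈⊤) q-path)))
  ... | _ , (p-path-in-H , _) , inj₂ refl =
    p-path-in-H , λ q q-path → p-min q (path-mono (λ _ → ∈⊤) q-path)

  shortest-extend : ∀ {u v p} → ShortestPathIn G H u v p → ShortestPathIn G ⊤ u v p
  shortest-extend (p-path@(p-walk , _) , p-min) = path-mono (λ _ → ∈⊤) p-path , λ q q-path →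
    let q′ , (q′-path , _) , q′≤q = shortcut q-path (walk-source p-walk) (walk-target p-walk)
    in ≤-trans (p-min q′ q′-path) (<⊎≡⇒≤ q′≤q)

  ftmv-extend : ∀ {k X} → IsFTMV k G H X → IsFTMV k G ⊤ X
  ftmv-extend (_ , visible) = (λ _ → ∈⊤) , λ u v u∈X v∈X u≢v ¬uv →
    let Q , shortest , avoiding , disjoint = visible u v u∈X v∈X u≢v ¬uv
    in Q , shortest-extend ∘ shortest , avoiding , disjoint

  ftmv-restrict : ∀ {k X Y} → IsFTMV k G ⊤ X → Y ⊆ X → Y ⊆ H → IsFTMV k G H Y
  ftmv-restrict (_ , visible) Y⊆X Y⊆H = Y⊆H , λ u v u∈Y v∈Y u≢v ¬uv →
    let Q , shortest , avoiding , disjoint = visible u v (Y⊆X u∈Y) (Y⊆X v∈Y) u≢v ¬uv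
    in Q , (λ i → shortest-restrict (shortest i) (Y⊆H u∈Y) (Y⊆H v∈Y)) ,
       (λ i w w∈Qᵢ w∈Y → avoiding i w w∈Qᵢ (Y⊆X w∈Y)) , disjoint

module _ {n} (σ : Setting n) where
  open IsComponentsOf (isComps σ)

  private
    G = graph σ
    C = comps σ

  S-clique : Clique G (S σ)
  S-clique = proj₁ (proj₁ (minCCS σ))

  S⊆hat : ∀ i → S σ ⊆ hat σ i
  S⊆hat i = q⊆p∪q (C i) (S σ)

  C⊆hat : ∀ i → C i ⊆ hat σ i
  C⊆hat i = p⊆p∪q (S σ)

  some-component : Fin (ℓ σ)
  some-component = fromℕ< (≤-trans (s≤s z≤n) (two≤ℓ σ))

  component-closed : ∀ i {a b} → a ∈ C i → Adj G a b → b ∉ S σ → b ∈ C i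
  component-closed i {a} {b} a∈Cᵢ ab b∉S with cover b b∉S
  ... | j , b∈Cⱼ =
    subst (λ j → b ∈ C j) (sym (separated i j a b a∈Cᵢ b∈Cⱼ edge)) b∈Cⱼ
    where
    edge : ∃ λ p → WalkIn G (∁ (S σ)) a b p
    edge = _ , step (inside i a∈Cᵢ) ab (single (x∉p⇒x∈∁p b∉S))

  hat-boundary : ∀ i {a b} → Adj G a b → a ∉ hat σ i → b ∈ hat σ i → b ∈ S σ
  hat-boundary i ab a∉Ĝ b∈Ĝ with x∈p∪q⁻ (C i) (S σ) b∈Ĝ
  ... | inj₂ b∈S = b∈S
  ... | inj₁ b∈C =
    ⊥-elim (a∉Ĝ (C⊆hat i (component-closed i b∈C (Adj-sym G ab) (a∉Ĝ ∘ S⊆hat i))))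

  module Hat (i : Fin (ℓ σ)) = CliqueBoundary G (hat σ i) (S σ) S-clique (hat-boundary i)

  hats-cover : ∀ x → ∃ λ i → x ∈ hat σ i
  hats-cover x with x ∈? S σ
  ... | yes x∈S = some-component , S⊆hat some-component x∈S
  ... | no x∉S  = let i , x∈Cᵢ = cover x x∉S in i , C⊆hat i x∈Cᵢ

  max-fμ-hat≤fμ : ∀ {k m ms} → IsFMu k G ⊤ m → (∀ i → IsFMu k G (hat σ i) (ms i)) →
                  maxF ms ≤ m
  max-fμ-hat≤fμ (_ , maximal) fμ-hat = maxF-lub λ i →
    let (X , X-ftmv , ∣X∣≡msᵢ) , _ = fμ-hat i
    in subst (_≤ _) ∣X∣≡msᵢ (maximal X (Hat.ftmv-extend i X-ftmv))

  ftmv-card≤sumF : ∀ {k} (ms : Fin (ℓ σ) → ℕ) →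
                   (∀ i X → IsFTMV k G (hat σ i) X → ∣ X ∣ ≤ ms i) →
                   ∀ X → IsFTMV k G ⊤ X → ∣ X ∣ ≤ sumF ms
  ftmv-card≤sumF ms bounded X X-ftmv =
    ≤-trans (∣p∣≤sumF∣p∩qᵢ∣ X (hat σ) (λ {x} _ → hats-cover x))
            (sumF-mono λ i → bounded i _ (Hat.ftmv-restrict i X-ftmv (p∩q⊆p X _) (p∩q⊆q X _)))

  fμ≤sum-fμ-hat : ∀ {k m ms} → IsFMu k G ⊤ m → (∀ i → IsFMu k G (hat σ i) (ms i)) →
                  m ≤ sumF ms
  fμ≤sum-fμ-hat ((X , X-ftmv , ∣X∣≡m) , _) fμ-hat =
    subst (_≤ _) ∣X∣≡m (ftmv-card≤sumF _ (proj₂ ∘ fμ-hat) X X-ftmv)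

  module _ {i j} (i≢j : i ≢ j) {x y} (x∈Cᵢ : x ∈ C i) (y∈Cⱼ : y ∈ C j) where

    no-walk-avoiding-S : ¬ (∃ λ p → WalkIn G (∁ (S σ)) x y p)
    no-walk-avoiding-S = i≢j ∘ separated i j x y x∈Cᵢ y∈Cⱼ

    walk-meets-S : ∀ {p} → WalkIn G ⊤ x y p → ∃ λ w → w ∈ₗ p × w ∈ S σ
    walk-meets-S walk with walk-meets-or-avoids (S σ) walk
    ... | inj₁ meets    = meets
    ... | inj₂ avoiding = ⊥-elim (no-walk-avoiding-S (_ , avoiding))

    distinct-components⇒≢ : x ≢ y
    distinct-components⇒≢ refl = i≢j (disjoint i j x x∈Cᵢ y∈Cⱼ)

    distinct-components⇒¬Adj : ¬ Adj G x y
    distinct-components⇒¬Adj xy =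
      no-walk-avoiding-S (_ , step (inside i x∈Cᵢ) xy (single (inside j y∈Cⱼ)))

  ftmv-meets-one-component : ∀ {k X} → 2 ≤ k → IsFTMV k G ⊤ X →
                             ∀ {x y i j} → x ∈ X → y ∈ X → x ∈ C i → y ∈ C j → i ≡ j
  ftmv-meets-one-component (s≤s (s≤s _)) (_ , visible) {x} {y} {i} {j} x∈X y∈X x∈Cᵢ y∈Cⱼ
    with i ≟ j
  ... | yes i≡j = i≡j
  ... | no i≢j
    with visible x y x∈X y∈X (distinct-components⇒≢ i≢j x∈Cᵢ y∈Cⱼ)
                             (distinct-components⇒¬Adj i≢j x∈Cᵢ y∈Cⱼ)
  ...   | Q , shortest , _ , disjoint =
    ⊥-elim (n≮n 2 (subst (2 <_) (size2 σ)
      (distinct₃⇒3≤∣p∣ (w∈S zero) (w∈S (# 1)) (w∈S (# 2))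
                       (w-injective λ ()) (w-injective λ ()) (w-injective λ ()))))
    where
    meets : ∀ r → ∃ λ w → w ∈ₗ Q r × w ∈ S σ
    meets r = walk-meets-S i≢j x∈Cᵢ y∈Cⱼ (proj₁ (proj₁ (shortest r)))
    w : ∀ r → Fin n
    w = proj₁ ∘ meets
    w∈Q : ∀ r → w r ∈ₗ Q r
    w∈Q = proj₁ ∘ proj₂ ∘ meets
    w∈S : ∀ r → w r ∈ S σ
    w∈S = proj₂ ∘ proj₂ ∘ meets
    w-injective : ∀ {r r′} → r ≢ r′ → w r ≢ w r′
    w-injective {r} {r′} r≢r′ wᵣ≡wᵣ′
      with disjoint r r′ r≢r′ (w r) (w∈Q r) (subst (_∈ₗ Q r′) (sym wᵣ≡wᵣ′) (w∈Q r′))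
    ... | inj₁ wᵣ≡x = x∈∁p⇒x∉p (inside i x∈Cᵢ) (subst (_∈ S σ) wᵣ≡x (w∈S r))
    ... | inj₂ wᵣ≡y = x∈∁p⇒x∉p (inside j y∈Cⱼ) (subst (_∈ S σ) wᵣ≡y (w∈S r))

  ftmv⊆hat : ∀ {k X} → 2 ≤ k → IsFTMV k G ⊤ X → ∃ λ i → X ⊆ hat σ i
  ftmv⊆hat {X = X} 2≤k X-ftmv with any? (λ x → x ∈? X ×-dec ¬? (x ∈? S σ))
  ... | yes (x , x∈X , x∉S) = let i , x∈Cᵢ = cover x x∉S in i , inside-hat x∈X x∈Cᵢ
    where
    inside-hat : ∀ {x i} → x ∈ X → x ∈ C i → X ⊆ hat σ i
    inside-hat x∈X x∈Cᵢ {y} y∈X with y ∈? S σ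
    ... | yes y∈S = S⊆hat _ y∈S
    ... | no y∉S  =
      let j , y∈Cⱼ = cover y y∉S
          i≡j  = ftmv-meets-one-component 2≤k X-ftmv x∈X y∈X x∈Cᵢ y∈Cⱼ
      in C⊆hat _ (subst (λ j → y ∈ C j) (sym i≡j) y∈Cⱼ)
  ... | no ∄x∉S = some-component , λ {y} y∈X →
    S⊆hat _ (decidable-stable (y ∈? S σ) (λ y∉S → ∄x∉S (y , y∈X , y∉S)))

  fμ≡max-fμ-hat : ∀ {k m ms} → 2 ≤ k → IsFMu k G ⊤ m → (∀ i → IsFMu k G (hat σ i) (ms i)) →
                  m ≡ maxF ms
  fμ≡max-fμ-hat {m = m} {ms} 2≤k fμ@((X , X-ftmv , ∣X∣≡m) , _) fμ-hat =
    ≤-antisym m≤max (max-fμ-hat≤fμ fμ fμ-hat)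
    where
    m≤max : m ≤ maxF ms
    m≤max =
      let i , X⊆Ĝᵢ = ftmv⊆hat 2≤k X-ftmv
      in subst (_≤ _) ∣X∣≡m
           (≤-trans (proj₂ (fμ-hat i) X (Hat.ftmv-restrict i X-ftmv id X⊆Ĝᵢ)) (maxF-upper ms i))

AtDistanceTwo : ∀ {n} → Graph n → Subset n → Fin n → Fin n → Set
AtDistanceTwo G Y u v = u ≢ v × ¬ Adj G u v × ∃ λ w → w ∈ Y × Adj G u w × Adj G w v

module _ {n} {G : Graph n} {Y : Subset n} where

  walk-length≥3 : ∀ {u v q} → u ≢ v → ¬ Adj G u v → WalkIn G Y u v q → 3 ≤ length q
  walk-length≥3 u≢v _   (single _)                         = ⊥-elim (u≢v refl)
  walk-length≥3 _   ¬uv (step _ uv (single _))             = ⊥-elim (¬uv uv)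
  walk-length≥3 _   _   (step _ _ (step _ _ (single _)))   = s≤s (s≤s (s≤s z≤n))
  walk-length≥3 _   _   (step _ _ (step _ _ (step _ _ _))) = s≤s (s≤s (s≤s z≤n))

  two-step-walk : ∀ {u v q} → u ≢ v → ¬ Adj G u v → WalkIn G Y u v q → length q ≤ 3 →
                  ∃ λ m → q ≡ u ∷ m ∷ v ∷ [] × m ∈ Y × Adj G u m × Adj G m v
  two-step-walk _ _ (step _ um (step m∈Y mv (single _))) _ = _ , refl , m∈Y , um , mv
  two-step-walk u≢v ¬uv walk@(single _) _ =
    ⊥-elim (<⇒≱ (walk-length≥3 u≢v ¬uv walk) (s≤s z≤n))
  two-step-walk u≢v ¬uv walk@(step _ _ (single _)) _ =
    ⊥-elim (<⇒≱ (walk-length≥3 u≢v ¬uv walk) (s≤s (s≤s z≤n)))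
  two-step-walk _ _ (step _ _ (step _ _ (step _ _ (single _))))   (s≤s (s≤s (s≤s ())))
  two-step-walk _ _ (step _ _ (step _ _ (step _ _ (step _ _ _)))) (s≤s (s≤s (s≤s ())))

  two-step-path : ∀ {u m v} → u ≢ v → u ∈ Y → m ∈ Y → v ∈ Y → Adj G u m → Adj G m v →
                  PathIn G Y u v (u ∷ m ∷ v ∷ [])
  two-step-path u≢v u∈Y m∈Y v∈Y um mv =
    step u∈Y um (step m∈Y mv (single v∈Y)) ,
    (Adj⇒≢ G um ∷ u≢v ∷ []) ∷ (Adj⇒≢ G mv ∷ []) ∷ [] ∷ []

  distance-two⇒shortest-has-middle : ∀ {u v q} → AtDistanceTwo G Y u v → u ∈ Y → v ∈ Y →
                                     ShortestPathIn G Y u v q →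
                                     ∃ λ m → q ≡ u ∷ m ∷ v ∷ [] × m ∈ Y × Adj G u m × Adj G m v
  distance-two⇒shortest-has-middle (u≢v , ¬uv , w , w∈Y , uw , wv) u∈Y v∈Y ((q-walk , _) , q-shortest) =
    two-step-walk u≢v ¬uv q-walk (q-shortest _ (two-step-path u≢v u∈Y w∈Y v∈Y uw wv))

  two-step-shortest : ∀ {u m v} → u ≢ v → ¬ Adj G u v → u ∈ Y → m ∈ Y → v ∈ Y →
                      Adj G u m → Adj G m v → ShortestPathIn G Y u v (u ∷ m ∷ v ∷ [])
  two-step-shortest u≢v ¬uv u∈Y m∈Y v∈Y um mv =
    two-step-path u≢v u∈Y m∈Y v∈Y um mv , λ _ q-path → walk-length≥3 u≢v ¬uv (proj₁ q-path)

neighbour-of-both⇒inner : ∀ {n} (G : Graph n) {u m v} → Adj G u m → Adj G m v → ¬ (m ≡ u ⊎ m ≡ v)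
neighbour-of-both⇒inner G um _  (inj₁ m≡u) = Adj⇒≢ G um (sym m≡u)
neighbour-of-both⇒inner G _  mv (inj₂ m≡v) = Adj⇒≢ G mv m≡v

end-or-middle : ∀ {A : Set} {w u m v : A} → w ∈ₗ u ∷ m ∷ v ∷ [] → (w ≡ u ⊎ w ≡ v) ⊎ w ≡ m
end-or-middle (here w≡u)                 = inj₁ (inj₁ w≡u)
end-or-middle (there (here w≡m))         = inj₂ w≡m
end-or-middle (there (there (here w≡v))) = inj₁ (inj₂ w≡v)

clique⇒ftmv : ∀ {n k} {G : Graph n} {Y X : Subset n} → Clique G X → X ⊆ Y → IsFTMV k G Y X
clique⇒ftmv X-clique X⊆Y = X⊆Y , λ u v u∈X v∈X u≢v ¬uv → ⊥-elim (¬uv (X-clique u v u∈X v∈X u≢v))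

clique⇒fμ : ∀ {n k} {G : Graph n} {Y : Subset n} → Clique G Y → IsFMu k G Y ∣ Y ∣
clique⇒fμ Y-clique = (_ , clique⇒ftmv Y-clique id , refl) , λ _ X-ftmv → p⊆q⇒∣p∣≤∣q∣ (proj₁ X-ftmv)

clique? : ∀ {n} (G : Graph n) (Y : Subset n) → Dec (Clique G Y)
clique? G Y = all? λ u → all? λ v → u ∈? Y →-dec v ∈? Y →-dec ¬? (u ≟ v) →-dec T? (adj G u v)

common-neighbours⇒ftmv : ∀ {n k} {G : Graph n} {Y X : Subset n} (h : Fin (suc k) → Fin n) →
                         (∀ r r′ → h r ≡ h r′ → r ≡ r′) → (∀ r → h r ∈ Y) → (∀ r → h r ∉ X) →
                         (∀ r u → u ∈ X → Adj G u (h r)) → X ⊆ Y → IsFTMV k G Y X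
common-neighbours⇒ftmv {G = G} {X = X} h h-injective h∈Y h∉X h-adjacent X⊆Y =
  X⊆Y , λ u v u∈X v∈X u≢v ¬uv →
    (λ r → u ∷ h r ∷ v ∷ []) ,
    (λ r → two-step-shortest u≢v ¬uv (X⊆Y u∈X) (h∈Y r) (X⊆Y v∈X)
                             (h-adjacent r u u∈X) (Adj-sym G (h-adjacent r v v∈X))) ,
    avoiding , disjoint
  where
  avoiding : ∀ {u v} r w → w ∈ₗ u ∷ h r ∷ v ∷ [] → w ∈ X → w ≡ u ⊎ w ≡ v
  avoiding r w w∈Q w∈X = [ id , (λ w≡hᵣ → ⊥-elim (h∉X r (subst (_∈ X) w≡hᵣ w∈X))) ] (end-or-middle w∈Q)
  disjoint : ∀ {u v} r r′ → r ≢ r′ → ∀ w → w ∈ₗ u ∷ h r ∷ v ∷ [] → w ∈ₗ u ∷ h r′ ∷ v ∷ [] →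
             w ≡ u ⊎ w ≡ v
  disjoint r r′ r≢r′ w w∈Qᵣ w∈Qᵣ′ with end-or-middle w∈Qᵣ | end-or-middle w∈Qᵣ′
  ... | inj₁ end   | _            = end
  ... | inj₂ _     | inj₁ end     = end
  ... | inj₂ w≡hᵣ  | inj₂ w≡hᵣ′  = ⊥-elim (r≢r′ (h-injective r r′ (trans (sym w≡hᵣ) w≡hᵣ′)))

atDistanceTwo? : ∀ {n} (G : Graph n) Y u v → Dec (AtDistanceTwo G Y u v)
atDistanceTwo? G Y u v =
  ¬? (u ≟ v) ×-dec ¬? (T? (adj G u v)) ×-dec
  any? λ w → w ∈? Y ×-dec T? (adj G u w) ×-dec T? (adj G w v)

ftmv₁-distance-two⇒2≤∣Y─X∣ : ∀ {n} {G : Graph n} {Y X : Subset n} {u v} →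
                            IsFTMV 1 G Y X → u ∈ X → v ∈ X → AtDistanceTwo G Y u v → 2 ≤ ∣ Y ─ X ∣
ftmv₁-distance-two⇒2≤∣Y─X∣ {G = G} {Y} {X} {u} {v} (X⊆Y , visible) u∈X v∈X d₂@(u≢v , ¬uv , _)
  with visible u v u∈X v∈X u≢v ¬uv
... | Q , shortest , avoiding , disjoint
  with distance-two⇒shortest-has-middle d₂ (X⊆Y u∈X) (X⊆Y v∈X) (shortest zero)
     | distance-two⇒shortest-has-middle d₂ (X⊆Y u∈X) (X⊆Y v∈X) (shortest (# 1))
... | m₀ , Q₀≡ , m₀∈Y , um₀ , m₀v | m₁ , Q₁≡ , m₁∈Y , um₁ , m₁v =
  distinct₂⇒2≤∣p∣ (outside zero m₀∈Q₀ m₀∈Y um₀ m₀v) (outside (# 1) m₁∈Q₁ m₁∈Y um₁ m₁v)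
    (λ m₀≡m₁ → neighbour-of-both⇒inner G um₀ m₀v
                 (disjoint zero (# 1) (λ ()) m₀ m₀∈Q₀ (subst (_∈ₗ Q (# 1)) (sym m₀≡m₁) m₁∈Q₁)))
  where
  m₀∈Q₀ : m₀ ∈ₗ Q zero
  m₀∈Q₀ = subst (m₀ ∈ₗ_) (sym Q₀≡) (there (here refl))
  m₁∈Q₁ : m₁ ∈ₗ Q (# 1)
  m₁∈Q₁ = subst (m₁ ∈ₗ_) (sym Q₁≡) (there (here refl))
  outside : ∀ r {m} → m ∈ₗ Q r → m ∈ Y → Adj G u m → Adj G m v → m ∈ Y ─ X
  outside r m∈Q m∈Y um mv =
    x∈p∧x∉q⇒x∈p─q m∈Y (neighbour-of-both⇒inner G um mv ∘ avoiding r _ m∈Q)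

BoundCertificate : ∀ {n} → Graph n → Subset n → ℕ → Set
BoundCertificate G Y b =
  ∀ X → X ⊆ Y → ∣ X ∣ ≤ b ⊎ (∣ Y ─ X ∣ < 2 × ∃₂ λ u v → u ∈ X × v ∈ X × AtDistanceTwo G Y u v)

certificate⇒ftmv₁-card≤ : ∀ {n} {G : Graph n} {Y : Subset n} {b} → BoundCertificate G Y b →
                          ∀ X → IsFTMV 1 G Y X → ∣ X ∣ ≤ b
certificate⇒ftmv₁-card≤ certificate X X-ftmv with certificate X (proj₁ X-ftmv)
... | inj₁ ∣X∣≤b = ∣X∣≤b
... | inj₂ (∣Y─X∣<2 , _ , _ , u∈X , v∈X , u-v) =
  ⊥-elim (<⇒≱ ∣Y─X∣<2 (ftmv₁-distance-two⇒2≤∣Y─X∣ X-ftmv u∈X v∈X u-v))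

all-subsets? : ∀ {n p} {P : Pred (Subset n) p} → Decidable P → Dec (∀ X → P X)
all-subsets? P? = map′ (λ ∄¬P X → decidable-stable (P? X) (λ ¬PX → ∄¬P (X , ¬PX)))
                       (λ ∀P (X , ¬PX) → ¬PX (∀P X))
                       (¬? (anySubset? (¬? ∘ P?)))

boundCertificate? : ∀ {n} (G : Graph n) Y b → Dec (BoundCertificate G Y b)
boundCertificate? G Y b = all-subsets? λ X → X ⊆? Y →-dec
  (∣ X ∣ ≤? b ⊎-dec (∣ Y ─ X ∣ <? 2 ×-dec
                     any? λ u → any? λ v → u ∈? X ×-dec v ∈? X ×-dec atDistanceTwo? G Y u v))

listed : ∀ {n} → List (ℕ × ℕ) → Fin n → Fin n → Bool
listed es u v = any (λ (x , y) → (x ≡ᵇ toℕ u) ∧ (y ≡ᵇ toℕ v)) es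

fromEdges : ∀ n (es : List (ℕ × ℕ)) → {True (all? λ (u : Fin n) → listed es u u ≟ᵇ false)} → Graph n
fromEdges n es {loopless} = record
  { adj    = λ u v → listed es u v ∨ listed es v u
  ; sym    = λ u v → ∨-comm (listed es u v) (listed es v u)
  ; irrefl = λ u → subst (λ b → b ∨ b ≡ false) (sym (toWitness loopless u)) refl
  }

module TwoApexes {n m} (G : Graph n) (s t : Fin n)
                 (C : Fin (2 + m) → Subset n) (centre : Fin (2 + m) → Fin n) where

  apexes : Subset n
  apexes = ⁅ s ⁆ ∪ ⁅ t ⁆

  universal? : ∀ h → Dec (∀ x → x ≢ h → Adj G h x)
  universal? h = all? λ x → ¬? (x ≟ h) →-dec T? (adj G h x)

  -- The implicit arguments below have unit type once their decisions evaluate to yes,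
  -- so for a concrete graph they are filled in automatically.
  module _ {s-universal : True (universal? s)} {t-universal : True (universal? t)}
           {two-apexes  : True (∣ apexes ∣ ≟ℕ 2)}
           {inside      : True (all? λ i → C i ⊆? ∁ apexes)}
           {centred     : True (all? λ i → centre i ∈? C i)}
           {covering    : True (all? λ x → ¬? (x ∈? apexes) →-dec any? λ i → x ∈? C i)}
           {disjoint    : True (all? λ i → all? λ j → all? λ x → x ∈? C i →-dec x ∈? C j →-dec i ≟ j)}
           {stars       : True (all? λ i → all? λ x →
                                  x ∈? C i →-dec ¬? (x ≟ centre i) →-dec T? (adj G (centre i) x))}
           {closed      : True (all? λ i → all? λ x → all? λ y →
                                  x ∈? C i →-dec y ∈? ∁ apexes →-dec T? (adj G x y) →-dec y ∈? C i)}
           where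

    private
      apex⁻ : ∀ {x} → x ∈ apexes → x ≡ s ⊎ x ≡ t
      apex⁻ x∈ = [ inj₁ ∘ x∈⁅y⁆⇒x≡y s , inj₂ ∘ x∈⁅y⁆⇒x≡y t ] (x∈p∪q⁻ ⁅ s ⁆ ⁅ t ⁆ x∈)

      connects : ∀ {h} → True (universal? h) → ∀ {T} → h ∉ T → ¬ DisconnectedIn G (∁ T)
      connects h-universal h∉T (u , v , u∉T , v∉T , no-walk) =
        no-walk (universal⇒walk _ (x∉p⇒x∈∁p h∉T) id (λ x _ → toWitness h-universal x) u v u∉T v∉T)

      apexes-clique : Clique G apexes
      apexes-clique u v u∈ v∈ u≢v with apex⁻ u∈ | apex⁻ v∈
      ... | inj₁ refl | inj₁ refl = ⊥-elim (u≢v refl)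
      ... | inj₁ refl | inj₂ refl = toWitness s-universal t (u≢v ∘ sym)
      ... | inj₂ refl | inj₁ refl = toWitness t-universal s (u≢v ∘ sym)
      ... | inj₂ refl | inj₂ refl = ⊥-elim (u≢v refl)

      apexes-minimal : ∀ T → T ⊆ apexes → T ≢ apexes → ¬ CliqueCutSet G T
      apexes-minimal T T⊆apexes T≢apexes (_ , disconnected) with s ∈? T | t ∈? T
      ... | yes s∈T | yes t∈T =
        T≢apexes (⊆-antisym T⊆apexes ([ (λ { refl → s∈T }) , (λ { refl → t∈T }) ] ∘ apex⁻))
      ... | no s∉T  | _       = connects s-universal s∉T disconnected
      ... | yes _   | no t∉T  = connects t-universal t∉T disconnected

      separated : ∀ i j u v → u ∈ C i → v ∈ C j → (∃ λ p → WalkIn G (∁ apexes) u v p) → i ≡ j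
      separated i j u v u∈Cᵢ v∈Cⱼ (_ , walk) =
        toWitness disjoint i j v (walk-stays-in (λ {x} {y} → toWitness closed i x y) walk u∈Cᵢ) v∈Cⱼ

      centre∈C : ∀ i → centre i ∈ C i
      centre∈C = toWitness centred

      centre∉apexes : ∀ i → centre i ∈ ∁ apexes
      centre∉apexes i = toWitness inside i (centre∈C i)

      centres-disconnected : ¬ (∃ λ p → WalkIn G (∁ apexes) (centre zero) (centre (suc zero)) p)
      centres-disconnected walk
        with separated zero (suc zero) _ _ (centre∈C zero) (centre∈C (suc zero)) walk
      ... | ()

    setting : Setting n
    setting = record
      { graph   = G
      ; conn    = universal⇒walk s ∈⊤ id (λ x _ → toWitness s-universal x)
      ; S       = apexes
      ; minCCS  = (apexes-clique ,
                   centre zero , centre (suc zero) , centre∉apexes zero , centre∉apexes (suc zero) ,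
                   centres-disconnected) ,
                  apexes-minimal
      ; size2   = toWitness two-apexes
      ; ℓ       = 2 + m
      ; comps   = C
      ; isComps = record
        { inside    = toWitness inside
        ; nonempty  = λ i → centre i , centre∈C i
        ; cover     = toWitness covering
        ; disjoint  = toWitness disjoint
        ; connected = λ i →
            universal⇒walk (centre i) (centre∉apexes i) (toWitness inside i) (toWitness stars i)
        ; separated = separated
        }
      ; two≤ℓ   = s≤s (s≤s z≤n)
      }

diamond : Graph 4
diamond = fromEdges 4 ((0 , 1) ∷ (0 , 2) ∷ (0 , 3) ∷ (1 , 2) ∷ (1 , 3) ∷ [])

diamond-tip : Fin 2 → Fin 4
diamond-tip zero       = # 2
diamond-tip (suc zero) = # 3

diamond-setting : Setting 4
diamond-setting = TwoApexes.setting diamond (# 0) (# 1) (⁅_⁆ ∘ diamond-tip) diamond-tip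

diamond-fμ : IsFMu 1 diamond ⊤ 3
diamond-fμ =
  (∁ ⁅ # 3 ⁆ , clique⇒ftmv (from-yes (clique? diamond (∁ ⁅ # 3 ⁆))) (λ _ → ∈⊤) , refl) ,
  certificate⇒ftmv₁-card≤ (from-yes (boundCertificate? diamond ⊤ 3))

diamond-hat-fμ : ∀ i → IsFMu 1 diamond (hat diamond-setting i) 3
diamond-hat-fμ zero       = clique⇒fμ (from-yes (clique? diamond (hat diamond-setting zero)))
diamond-hat-fμ (suc zero) = clique⇒fμ (from-yes (clique? diamond (hat diamond-setting (suc zero))))

twoStars : Graph 10
twoStars = fromEdges 10 ((0 , 1) ∷ map (0 ,_) others ++ map (1 ,_) others ++
                         (2 , 3) ∷ (2 , 4) ∷ (2 , 5) ∷ (6 , 7) ∷ (6 , 8) ∷ (6 , 9) ∷ [])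
  where
  others : List ℕ
  others = 2 ∷ 3 ∷ 4 ∷ 5 ∷ 6 ∷ 7 ∷ 8 ∷ 9 ∷ []

star : Fin 2 → Subset 10
star zero       = false ∷ false ∷ true  ∷ true  ∷ true  ∷ true  ∷ false ∷ false ∷ false ∷ false ∷ []
star (suc zero) = false ∷ false ∷ false ∷ false ∷ false ∷ false ∷ true  ∷ true  ∷ true  ∷ true  ∷ []

star-centre : Fin 2 → Fin 10
star-centre zero       = # 2
star-centre (suc zero) = # 6

twoStars-setting : Setting 10
twoStars-setting = TwoApexes.setting twoStars (# 0) (# 1) star star-centre

twoStars-apex : Fin 2 → Fin 10
twoStars-apex zero       = # 0
twoStars-apex (suc zero) = # 1

twoStars-apex-injective : ∀ r r′ → twoStars-apex r ≡ twoStars-apex r′ → r ≡ r′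
twoStars-apex-injective zero       zero       _ = refl
twoStars-apex-injective (suc zero) (suc zero) _ = refl
twoStars-apex-injective zero       (suc zero) ()
twoStars-apex-injective (suc zero) zero       ()

twoStars-ftmv : ∀ Y X → {True (X ⊆? Y)} →
                {True (all? λ r → twoStars-apex r ∈? Y ×-dec ¬? (twoStars-apex r ∈? X))} →
                {True (all? λ r → all? λ u → u ∈? X →-dec T? (adj twoStars u (twoStars-apex r)))} →
                IsFTMV 1 twoStars Y X
twoStars-ftmv Y X {X⊆Y} {apexes-outside} {adjacent} =
  common-neighbours⇒ftmv twoStars-apex twoStars-apex-injective
    (proj₁ ∘ toWitness apexes-outside) (proj₂ ∘ toWitness apexes-outside)
    (toWitness adjacent) (toWitness X⊆Y)

twoStars-hat-fμ : ∀ i → IsFMu 1 twoStars (hat twoStars-setting i) 4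
twoStars-hat-fμ zero =
  (star zero , twoStars-ftmv (hat twoStars-setting zero) (star zero) , refl) ,
  certificate⇒ftmv₁-card≤ (from-yes (boundCertificate? twoStars (hat twoStars-setting zero) 4))
twoStars-hat-fμ (suc zero) =
  (star (suc zero) , twoStars-ftmv (hat twoStars-setting (suc zero)) (star (suc zero)) , refl) ,
  certificate⇒ftmv₁-card≤ (from-yes (boundCertificate? twoStars (hat twoStars-setting (suc zero)) 4))

twoStars-fμ : IsFMu 1 twoStars ⊤ 8
twoStars-fμ =
  (∁ (S twoStars-setting) , twoStars-ftmv ⊤ (∁ (S twoStars-setting)) , refl) ,
  ftmv-card≤sumF twoStars-setting (λ _ → 4) (proj₂ ∘ twoStars-hat-fμ)

proposition3p6 :
    -- (i) the two bounds for k = 1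
    (∀ {n} (σ : Setting n) (m : ℕ) (ms : Fin' σ → ℕ) →
      IsFMu 1 (graph σ) ⊤ m → (∀ i → IsFMu 1 (graph σ) (hat σ i) (ms i)) →
      maxF ms ≤ m × m ≤ sumF ms)
    -- (i) sharpness of the lower bound
    × (Σ ℕ λ n → Σ (Setting n) λ σ → Σ ℕ λ m → Σ (Fin' σ → ℕ) λ ms →
        IsFMu 1 (graph σ) ⊤ m × (∀ i → IsFMu 1 (graph σ) (hat σ i) (ms i)) × m ≡ maxF ms)
    -- (i) sharpness of the upper bound
    × (Σ ℕ λ n → Σ (Setting n) λ σ → Σ ℕ λ m → Σ (Fin' σ → ℕ) λ ms →
        IsFMu 1 (graph σ) ⊤ m × (∀ i → IsFMu 1 (graph σ) (hat σ i) (ms i)) × m ≡ sumF ms)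
    -- (ii) k ≥ 2
    × (∀ (k : ℕ) → 2 ≤ k → ∀ {n} (σ : Setting n) (m : ℕ) (ms : Fin' σ → ℕ) →
        IsFMu k (graph σ) ⊤ m → (∀ i → IsFMu k (graph σ) (hat σ i) (ms i)) →
        m ≡ maxF ms)
proposition3p6 =
  (λ σ _ _ fμ fμ-hat → max-fμ-hat≤fμ σ fμ fμ-hat , fμ≤sum-fμ-hat σ fμ fμ-hat) ,
  (4  , diamond-setting  , 3 , (λ _ → 3) , diamond-fμ  , diamond-hat-fμ  , refl) ,
  (10 , twoStars-setting , 8 , (λ _ → 4) , twoStars-fμ , twoStars-hat-fμ , refl) ,
  (λ _ 2≤k σ _ _ → fμ≡max-fμ-hat σ 2≤k)
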